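{- Let $n\ge 0$ and $m>1$ be integers. Let $Y\subseteq D_n^5$ satisfy $\pi(Y)=Y$ for every permutation $\pi\in S_n$, and let $x,y\in D_n$ with $x\sim y$. Then: (1) $F(\{x\}\times Y)=F(\{y\}\times Y)$; (2) $F([x]\times Y)=\gamma(x)\cdot F(\{x\}\times Y)$; (3) if $m$ divides $\gamma(x)$, then $m$ divides $F([x]\times Y)$; (4) $m$ divides $F(E_{n,m}\times Y)$.
   Context: $D_n$ is the set of monotone Boolean functions $\{0,1\}^n\to\{0,1\}$ ($\{0,1\}^n$ ordered componentwise), partially ordered pointwise. $\top,\bot$ are the constant functions $1,0$; $x|y$ and $x\&y$ are pointwise max and min; $\mathrm{re}(x,y)=|\{z\in D_n:x\le z\le y\}|$. For $a,b,c,d,e,f\in D_n$ define $F(a,b,c,d,e,f)=U\cdot L$, where $$U=\sum_{u\in D_n,\ u\ge a|b|c|d|e|f}\mathrm{re}(a|b|d,u)\,\mathrm{re}(a|c|e,u)\,\mathrm{re}(b|c|f,u)\,\mathrm{re}(d|e|f,u),$$ $$L=\sum_{u\in D_n,\ u\le a\&b\&c\&d\&e\&f}\mathrm{re}(u,a\&b\&c)\,\mathrm{re}(u,a\&d\&e)\,\mathrm{re}(u,b\&d\&f)\,\mathrm{re}(u,c\&e\&f),$$ and for $A\subseteq D_n^6$, $F(A)=\sum_{(a,\dots,f)\in A}F(a,b,c,d,e,f)$; here $\{x\}\times Y$ and $[x]\times Y$ are regarded as subsets of $D_n^6$. A permutation $\pi\in S_n$ acts on $g\in D_n$ by $\pi(g)=g\circ\pi$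 where $\pi(u)=u\circ\pi$ for $u\in\{0,1\}^n$, on tuples componentwise, and on sets of tuples elementwise. $f\sim g$ iff $f=\pi(g)$ for some $\pi\in S_n$; $[f]$ is the class of $f$, $\gamma(f)=|[f]|$. $E_{n,m}=\{f\in D_n:\gamma(f)\equiv0\pmod m\}$. -}

module Defs where

open import Data.Nat using (ℕ; zero; suc; _+_; _*_)
open import Data.Nat.Divisibility using (_∣?_)
open import Data.Bool using (Bool; true; false; _∧_; _∨_; not; if_then_else_)
open import Data.Fin using (Fin; _≟_)
open import Data.Vec using (Vec; []; _∷_; lookup; tabulate)
open import Data.List using (List; []; _∷_; map; filterᵇ; length; concatMap; cartesianProduct; allFin)
open import Data.Bool.ListAction using (all; any)
open import Data.Nat.ListAction using (sum)
open import Data.Product using (_×_; _,_)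
open import Relation.Nullary.Decidable using (⌊_⌋)
open import Relation.Binary.PropositionalEquality using (_≡_)

Point : ℕ → Set
Point n = Vec Bool n

allPoints : (n : ℕ) → List (Point n)
allPoints zero = [] ∷ []
allPoints (suc n) = map (false ∷_) (allPoints n) Data.List.++ map (true ∷_) (allPoints n)

_≤ᵇ_ : Bool → Bool → Bool
a ≤ᵇ b = not a ∨ b

leqPt : ∀ {n} → Point n → Point n → Bool
leqPt [] [] = true
leqPt (a ∷ u) (b ∷ v) = (a ≤ᵇ b) ∧ leqPt u v

-- Boolean functions {0,1}^n → {0,1}, represented by their (decision-tree) truth table
BF : ℕ → Set
BF zero = Bool
BF (suc n) = BF n × BF n   -- (restriction to x₀ = 0 , restriction to x₀ = 1)

eval : ∀ {n} → BF n → Point n → Bool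
eval {zero} b [] = b
eval {suc n} (f₀ , f₁) (false ∷ u) = eval f₀ u
eval {suc n} (f₀ , f₁) (true ∷ u) = eval f₁ u

tab : ∀ {n} → (Point n → Bool) → BF n
tab {zero} f = f []
tab {suc n} f = tab (λ u → f (false ∷ u)) , tab (λ u → f (true ∷ u))

allBF : (n : ℕ) → List (BF n)
allBF zero = false ∷ true ∷ []
allBF (suc n) = cartesianProduct (allBF n) (allBF n)

eqBF : ∀ {n} → BF n → BF n → Bool
eqBF {zero} a b = (a ≤ᵇ b) ∧ (b ≤ᵇ a)
eqBF {suc n} (f₀ , f₁) (g₀ , g₁) = eqBF f₀ g₀ ∧ eqBF f₁ g₁

monotoneᵇ : ∀ {n} → BF n → Bool
monotoneᵇ {n} f = all (λ u → all (λ v → not (leqPt u v) ∨ (eval f u ≤ᵇ eval f v)) (allPoints n)) (allPoints n)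

InD : ∀ {n} → BF n → Set
InD f = monotoneᵇ f ≡ true

D : (n : ℕ) → List (BF n)
D n = filterᵇ monotoneᵇ (allBF n)

leqBF : ∀ {n} → BF n → BF n → Bool
leqBF {n} f g = all (λ u → eval f u ≤ᵇ eval g u) (allPoints n)

_∣ᶠ_ : ∀ {n} → BF n → BF n → BF n
f ∣ᶠ g = tab (λ u → eval f u ∨ eval g u)

_&ᶠ_ : ∀ {n} → BF n → BF n → BF n
f &ᶠ g = tab (λ u → eval f u ∧ eval g u)

infixl 6 _∣ᶠ_
infixl 7 _&ᶠ_

re : ∀ {n} → BF n → BF n → ℕ
re {n} x y = length (filterᵇ (λ z → leqBF x z ∧ leqBF z y) (D n))

Tup5 : ℕ → Set
Tup5 n = BF n × BF n × BF n × BF n × BF n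

D5 : (n : ℕ) → List (Tup5 n)
D5 n = concatMap (λ b → concatMap (λ c → concatMap (λ d → concatMap (λ e → map (λ f → (b , c , d , e , f)) (D n)) (D n)) (D n)) (D n)) (D n)

InD5 : ∀ {n} → Tup5 n → Set
InD5 (b , c , d , e , f) = monotoneᵇ b ∧ monotoneᵇ c ∧ monotoneᵇ d ∧ monotoneᵇ e ∧ monotoneᵇ f ≡ true

Fval : ∀ {n} → BF n → Tup5 n → ℕ
Fval {n} a (b , c , d , e , f) = U * L
  where
  U = sum (map (λ u → re (a ∣ᶠ b ∣ᶠ d) u * re (a ∣ᶠ c ∣ᶠ e) u * re (b ∣ᶠ c ∣ᶠ f) u * re (d ∣ᶠ e ∣ᶠ f) u)
               (filterᵇ (λ u → leqBF (a ∣ᶠ b ∣ᶠ c ∣ᶠ d ∣ᶠ e ∣ᶠ f) u) (D n)))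
  L = sum (map (λ u → re u (a &ᶠ b &ᶠ c) * re u (a &ᶠ d &ᶠ e) * re u (b &ᶠ d &ᶠ f) * re u (c &ᶠ e &ᶠ f))
               (filterᵇ (λ u → leqBF u (a &ᶠ b &ᶠ c &ᶠ d &ᶠ e &ᶠ f)) (D n)))

actPt : ∀ {n} → (Fin n → Fin n) → Point n → Point n
actPt π u = tabulate (λ i → lookup u (π i))

act : ∀ {n} → (Fin n → Fin n) → BF n → BF n
act π g = tab (λ u → eval g (actPt π u))

act5 : ∀ {n} → (Fin n → Fin n) → Tup5 n → Tup5 n
act5 π (b , c , d , e , f) = act π b , act π c , act π d , act π e , act π f

allVecs : (n k : ℕ) → List (Vec (Fin n) k)
allVecs n zero = [] ∷ []
allVecs n (suc k) = concatMap (λ i → map (i ∷_) (allVecs n k)) (allFin n)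

injectiveᵇ : ∀ {n} → (Fin n → Fin n) → Bool
injectiveᵇ {n} σ = all (λ i → all (λ j → ⌊ i ≟ j ⌋ ∨ not ⌊ σ i ≟ σ j ⌋) (allFin n)) (allFin n)

Sym : (n : ℕ) → List (Fin n → Fin n)
Sym n = filterᵇ injectiveᵇ (map lookup (allVecs n n))

inClassᵇ : ∀ {n} → BF n → BF n → Bool
inClassᵇ f g = any (λ σ → eqBF g (act σ f)) (Sym _)

γ : ∀ {n} → BF n → ℕ
γ {n} f = length (filterᵇ (inClassᵇ f) (D n))

FsetY : ∀ {n} → List (BF n) → (Tup5 n → Bool) → ℕ
FsetY {n} S Y = sum (map (λ g → sum (map (Fval g) (filterᵇ Y (D5 n)))) S)

Fsingle : ∀ {n} → BF n → (Tup5 n → Bool) → ℕ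
Fsingle x Y = FsetY (x ∷ []) Y

Fclass : ∀ {n} → BF n → (Tup5 n → Bool) → ℕ
Fclass {n} x Y = FsetY (filterᵇ (inClassᵇ x) (D n)) Y

E : (n m : ℕ) → List (BF n)
E n m = filterᵇ (λ g → ⌊ m ∣? γ g ⌋) (D n)

-- A permutation π ∈ S_n acts on D_n by lattice automorphisms: it commutes with pointwise | and &,
-- preserves ≤ and permutes D_n. Hence re(π x, π y) = re(x, y), and reindexing the sums over D_n by π
-- gives F(π a, …, π f) = F(a, …, f). For Y invariant under S_n, reindexing the sum over Y as well shows
-- that g ↦ F({g} × Y) is constant on classes; this is (1), and summing over [x] gives (2) and (3).
-- Membership in E_{n,m} depends only on the class, so E_{n,m} is a disjoint union of classes [g], each
-- contributing γ(g) · F({g} × Y) with m ∣ γ(g); this is (4).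

module Submission where

open import Defs
open import Data.Bool using (Bool; true; false; T; not; _∧_; _∨_; if_then_else_)
open import Data.Bool.Properties using (T-∧; T-≡)
open import Data.Bool.ListAction using (all)
open import Data.Empty using (⊥; ⊥-elim)
open import Data.Fin using (Fin; zero; suc; _≟_; punchOut)
open import Data.Fin.Properties using (any?; punchOut-injective; injective⇒≤)
open import Data.Fin.Permutation
  using (Permutation; _⟨$⟩ʳ_; _⟨$⟩ˡ_; permutation; inverseˡ; inverseʳ; flip; _∘ₚ_)
import Data.Fin.Permutation as Permutation
open import Data.List using (List; []; _∷_; map; filterᵇ; length; concatMap; allFin)
open import Data.List.Properties using (map-∘; map-cong; map-cong-local; map-++; length-map; filter-≐; filter-notAll)
open import Data.List.Membership.Propositional using (_∈_; find; lose)
open import Data.List.Membership.Propositional.Properties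
  using (∈-map⁺; ∈-map⁻; ∈-filter⁺; ∈-filter⁻; ∈-concatMap⁺; ∈-allFin; ∈-cartesianProduct⁺;
         ∈-++⁺ˡ; ∈-++⁺ʳ)
open import Data.List.Membership.Propositional.Properties.WithK using (unique∧set⇒bag)
open import Data.List.Relation.Binary.BagAndSetEquality using (∼bag⇒↭)
open import Data.List.Relation.Binary.Permutation.Propositional using (_↭_; ↭-sym; ↭-trans; ↭-reflexive)
open import Data.List.Relation.Binary.Permutation.Propositional.Properties using (filter-↭; ↭-length)
import Data.List.Relation.Binary.Permutation.Propositional.Properties as ↭
open import Data.List.Relation.Unary.All as All using (All; []; _∷_)
open import Data.List.Relation.Unary.All.Properties using (all⁺; all⁻; all-filter; concat⁺)
import Data.List.Relation.Unary.All.Properties as All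
open import Data.List.Relation.Unary.Any using (here; there)
import Data.List.Relation.Unary.Any as Any
open import Data.List.Relation.Unary.Any.Properties using (any⁺; any⁻)
open import Data.List.Relation.Unary.AllPairs using ([]; _∷_)
open import Data.List.Relation.Unary.Unique.Propositional using (Unique)
import Data.List.Relation.Unary.Unique.Propositional.Properties as Unique
open import Data.Nat using (ℕ; zero; suc; _+_; _*_; _<_; _≤_; s≤s)
open import Data.Nat.Divisibility using (_∣_; _∣?_; _∣0; ∣m∣n⇒∣m+n; ∣-trans; m∣m*n)
open import Data.Nat.ListAction using (sum)
open import Data.Nat.ListAction.Properties using (sum-++; sum-↭)
open import Data.Nat.Properties using (+-identityʳ; +-assoc; +-commutativeSemigroup; ≤-refl; <-≤-trans; 1+n≰n)
open import Algebra.Properties.CommutativeSemigroup +-commutativeSemigroup using (x∙yz≈y∙xz)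
open import Data.Product using (_×_; _,_; proj₁; proj₂; ∃)
open import Data.Vec using (Vec; []; _∷_; lookup; tabulate)
open import Data.Vec.Properties using (lookup∘tabulate; tabulate∘lookup; tabulate-cong)
open import Function using (_∘_; id; Equivalence; mk⇔)
open import Function.Definitions using (Injective)
open import Relation.Binary.Structures using (IsEquivalence)
open import Relation.Binary.PropositionalEquality
open import Relation.Nullary using (yes; no)
open import Relation.Nullary.Decidable using (⌊_⌋; T?; toWitness)

T-ext : ∀ {a b : Bool} → (T a → T b) → (T b → T a) → a ≡ b
T-ext {false} {false} _ _ = refl
T-ext {false} {true} _ b⇒a = ⊥-elim (b⇒a _)
T-ext {true} {false} a⇒b _ = ⊥-elim (a⇒b _)
T-ext {true} {true} _ _ = refl

T-not : ∀ {b} → T (not b) → T b → ⊥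
T-not {true} ()

≤ᵇ-elim : ∀ {a b} → T (a ≤ᵇ b) → T a → T b
≤ᵇ-elim {true} a⇒b _ = a⇒b

≤ᵇ-intro : ∀ {a b} → (T a → T b) → T (a ≤ᵇ b)
≤ᵇ-intro {false} _ = _
≤ᵇ-intro {true} a⇒b = a⇒b _

module _ {A : Set} (p : A → Bool) (xs : List A) where

  T-all⁻ : T (all p xs) → ∀ {x} → x ∈ xs → T (p x)
  T-all⁻ h = All.lookup (all⁺ p xs h)

  T-all⁺ : (∀ {x} → x ∈ xs → T (p x)) → T (all p xs)
  T-all⁺ h = all⁻ p (All.tabulate h)

module _ {A : Set} where

  filterᵇ-cong : ∀ {p q : A → Bool} → (∀ x → p x ≡ q x) → ∀ xs → filterᵇ p xs ≡ filterᵇ q xs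
  filterᵇ-cong {p} {q} p≗q =
    filter-≐ (T? ∘ p) (T? ∘ q) ((λ {x} → subst T (p≗q x)) , (λ {x} → subst T (sym (p≗q x))))

  filterᵇ-map : ∀ (p : A → Bool) (f : A → A) xs → filterᵇ p (map f xs) ≡ map f (filterᵇ (p ∘ f) xs)
  filterᵇ-map p f [] = refl
  filterᵇ-map p f (x ∷ xs) with p (f x)
  ... | true = cong (f x ∷_) (filterᵇ-map p f xs)
  ... | false = filterᵇ-map p f xs

  filterᵇ-filterᵇ : ∀ (p q : A → Bool) xs → filterᵇ p (filterᵇ q xs) ≡ filterᵇ (λ x → q x ∧ p x) xs
  filterᵇ-filterᵇ p q [] = refl
  filterᵇ-filterᵇ p q (x ∷ xs) with q x
  ... | false = filterᵇ-filterᵇ p q xs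
  ... | true with p x
  ...   | true = cong (x ∷_) (filterᵇ-filterᵇ p q xs)
  ...   | false = filterᵇ-filterᵇ p q xs

  filterᵇ-filterᵇ-⇒ : ∀ {p q : A → Bool} → (∀ {x} → T (p x) → T (q x)) →
                      ∀ xs → filterᵇ p (filterᵇ q xs) ≡ filterᵇ p xs
  filterᵇ-filterᵇ-⇒ {p} {q} p⇒q xs = trans (filterᵇ-filterᵇ p q xs)
    (filterᵇ-cong (λ x → T-ext (proj₂ ∘ Equivalence.to T-∧) (λ px → Equivalence.from T-∧ (p⇒q px , px))) xs)

  sum-filterᵇ : ∀ (p : A → Bool) (h : A → ℕ) xs →
                sum (map h (filterᵇ p xs)) ≡ sum (map (λ x → if p x then h x else 0) xs)
  sum-filterᵇ p h [] = refl
  sum-filterᵇ p h (x ∷ xs) with p x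
  ... | true = cong (h x +_) (sum-filterᵇ p h xs)
  ... | false = sum-filterᵇ p h xs

  sum-filterᵇ-split : ∀ (p : A → Bool) (h : A → ℕ) xs →
                      sum (map h xs) ≡ sum (map h (filterᵇ p xs)) + sum (map h (filterᵇ (not ∘ p) xs))
  sum-filterᵇ-split p h [] = refl
  sum-filterᵇ-split p h (x ∷ xs) with p x
  ... | true = trans (cong (h x +_) (sum-filterᵇ-split p h xs)) (sym (+-assoc (h x) _ _))
  ... | false = trans (cong (h x +_) (sum-filterᵇ-split p h xs)) (x∙yz≈y∙xz (h x) (sum (map h (filterᵇ p xs))) _)

  sum-map-const : ∀ {h : A → ℕ} {c xs} → All (λ x → h x ≡ c) xs → sum (map h xs) ≡ length xs * c
  sum-map-const [] = refl
  sum-map-const (hx≡c ∷ h≡c) = cong₂ _+_ hx≡c (sum-map-const h≡c)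

  sum-concatMap : ∀ {B : Set} (h : B → ℕ) (f : A → List B) xs →
                  sum (map h (concatMap f xs)) ≡ sum (map (sum ∘ map h ∘ f) xs)
  sum-concatMap h f [] = refl
  sum-concatMap h f (x ∷ xs) = trans (cong sum (map-++ h (f x) (concatMap f xs)))
    (trans (sum-++ (map h (f x)) _) (cong (sum (map h (f x)) +_) (sum-concatMap h f xs)))

module _ {A : Set} {f : A → A} {xs : List A} (f-permutes : map f xs ↭ xs) where

  sum-map-reindex : ∀ (h : A → ℕ) → sum (map (h ∘ f) xs) ≡ sum (map h xs)
  sum-map-reindex h = trans (cong sum (map-∘ xs)) (sum-↭ (↭.map⁺ h f-permutes))

  filterᵇ-reindex : ∀ {p q : A → Bool} → (∀ x → p (f x) ≡ q x) → filterᵇ p xs ↭ map f (filterᵇ q xs)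
  filterᵇ-reindex {p} {q} pf≗q = ↭-trans (filter-↭ (T? ∘ p) (↭-sym f-permutes))
    (↭-reflexive (trans (filterᵇ-map p f xs) (cong (map f) (filterᵇ-cong pf≗q xs))))

  length-filterᵇ-reindex : ∀ {p q : A → Bool} → (∀ x → p (f x) ≡ q x) →
                           length (filterᵇ p xs) ≡ length (filterᵇ q xs)
  length-filterᵇ-reindex {p} {q} pf≗q =
    trans (↭-length (filterᵇ-reindex {p} {q} pf≗q)) (length-map f (filterᵇ q xs))

  sum-filterᵇ-reindex : ∀ {p q : A → Bool} {h k : A → ℕ} →
                        (∀ x → p (f x) ≡ q x) → (∀ x → h (f x) ≡ k x) →
                        sum (map h (filterᵇ p xs)) ≡ sum (map k (filterᵇ q xs))
  sum-filterᵇ-reindex {p} {q} {h} pf≗q hf≗k = trans (sum-↭ (↭.map⁺ h (filterᵇ-reindex {p} {q} pf≗q)))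
    (cong sum (trans (sym (map-∘ (filterᵇ q xs))) (map-cong hf≗k (filterᵇ q xs))))

-- Sums over the classes of an equivalence relation

module EquivalenceClasses {A : Set} {related : A → A → Bool}
  (isEquivalence : IsEquivalence (λ x y → T (related x y))) (xs : List A) where

  open IsEquivalence isEquivalence renaming (refl to ~-refl; sym to ~-sym; trans to ~-trans)

  classSize : A → ℕ
  classSize x = length (filterᵇ (related x) xs)

  classSize-cong : ∀ {x y} → T (related x y) → classSize x ≡ classSize y
  classSize-cong x~y = cong length (filterᵇ-cong (λ z → T-ext (~-trans (~-sym x~y)) (~-trans x~y)) xs)

  module _ (S : A → ℕ) (S-cong : ∀ {x y} → T (related x y) → S y ≡ S x) where

    sum-class : ∀ x → sum (map S (filterᵇ (related x) xs)) ≡ classSize x * S x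
    sum-class x = sum-map-const (All.map S-cong (all-filter (T? ∘ related x) xs))

    module _ {Q : A → Bool} (Q-cong : ∀ {x y} → T (related x y) → Q x ≡ Q y) {g} (g∈Q : g ∈ filterᵇ Q xs) where

      Q∖[g] : A → Bool
      Q∖[g] x = Q x ∧ not (related g x)

      Q∖[g]-cong : ∀ {x y} → T (related x y) → Q∖[g] x ≡ Q∖[g] y
      Q∖[g]-cong x~y = cong₂ (λ a b → a ∧ not b) (Q-cong x~y)
        (T-ext (λ g~x → ~-trans g~x x~y) (λ g~y → ~-trans g~y (~-sym x~y)))

      sum-filterᵇ-class : sum (map S (filterᵇ Q xs)) ≡ classSize g * S g + sum (map S (filterᵇ Q∖[g] xs))
      sum-filterᵇ-class = begin
        sum (map S (filterᵇ Q xs))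
          ≡⟨ sum-filterᵇ-split (related g) S (filterᵇ Q xs) ⟩
        sum (map S (filterᵇ (related g) (filterᵇ Q xs))) + sum (map S (filterᵇ (not ∘ related g) (filterᵇ Q xs)))
          ≡⟨ cong₂ (λ ys zs → sum (map S ys) + sum (map S zs))
                   (filterᵇ-filterᵇ-⇒ (λ g~x → subst T (Q-cong g~x) Qg) xs)
                   (filterᵇ-filterᵇ (not ∘ related g) Q xs) ⟩
        sum (map S (filterᵇ (related g) xs)) + sum (map S (filterᵇ Q∖[g] xs))
          ≡⟨ cong (_+ sum (map S (filterᵇ Q∖[g] xs))) (sum-class g) ⟩
        classSize g * S g + sum (map S (filterᵇ Q∖[g] xs)) ∎
        where
        open ≡-Reasoning
        Qg : T (Q g)
        Qg = proj₂ (∈-filter⁻ (T? ∘ Q) {xs = xs} g∈Q)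

      length-filterᵇ-Q∖[g] : length (filterᵇ Q∖[g] xs) < length (filterᵇ Q xs)
      length-filterᵇ-Q∖[g] =
        subst (λ ys → length ys < length (filterᵇ Q xs)) (filterᵇ-filterᵇ (not ∘ related g) Q xs)
        (filter-notAll (T? ∘ not ∘ related g) (filterᵇ Q xs) (lose g∈Q λ ¬g~g → T-not ¬g~g ~-refl))

    ∣-sum-filterᵇ : ∀ {m} (Q : A → Bool) → (∀ {x y} → T (related x y) → Q x ≡ Q y) →
                    (∀ {x} → T (Q x) → m ∣ classSize x) → m ∣ sum (map S (filterᵇ Q xs))
    ∣-sum-filterᵇ {m} Q Q-cong Q⇒∣ = go (suc (length (filterᵇ Q xs))) Q-cong Q⇒∣ ≤-refl
      where
      go : ∀ k {Q : A → Bool} → (∀ {x y} → T (related x y) → Q x ≡ Q y) →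
           (∀ {x} → T (Q x) → m ∣ classSize x) →
           length (filterᵇ Q xs) < k → m ∣ sum (map S (filterᵇ Q xs))
      go (suc k) {Q} Q-cong Q⇒∣ (s≤s bound) with filterᵇ Q xs in eq
      ... | [] = m ∣0
      ... | g ∷ _ = subst (λ ys → m ∣ sum (map S ys)) eq
                      (subst (m ∣_) (sym (sum-filterᵇ-class Q-cong g∈Q)) (∣m∣n⇒∣m+n m∣class m∣rest))
        where
        g∈Q : g ∈ filterᵇ Q xs
        g∈Q = subst (g ∈_) (sym eq) (here refl)
        m∣class : m ∣ classSize g * S g
        m∣class = ∣-trans (Q⇒∣ (proj₂ (∈-filter⁻ (T? ∘ Q) {xs = xs} g∈Q))) (m∣m*n _)
        m∣rest : m ∣ sum (map S (filterᵇ (Q∖[g] Q-cong g∈Q) xs))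
        m∣rest = go k (Q∖[g]-cong Q-cong g∈Q) (Q⇒∣ ∘ proj₁ ∘ Equivalence.to T-∧)
          (<-≤-trans (length-filterᵇ-Q∖[g] Q-cong g∈Q) (subst (λ ys → length ys ≤ k) (sym eq) bound))

eval-tab : ∀ {n} (h : Point n → Bool) u → eval (tab h) u ≡ h u
eval-tab {zero} h [] = refl
eval-tab {suc n} h (false ∷ u) = eval-tab (λ v → h (false ∷ v)) u
eval-tab {suc n} h (true ∷ u) = eval-tab (λ v → h (true ∷ v)) u

tab-eval : ∀ {n} (f : BF n) → tab (eval f) ≡ f
tab-eval {zero} f = refl
tab-eval {suc n} (f₀ , f₁) = cong₂ _,_ (tab-eval f₀) (tab-eval f₁)

tab-cong : ∀ {n} {h k : Point n → Bool} → (∀ u → h u ≡ k u) → tab h ≡ tab k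
tab-cong {zero} h≗k = h≗k []
tab-cong {suc n} h≗k = cong₂ _,_ (tab-cong (h≗k ∘ (false ∷_))) (tab-cong (h≗k ∘ (true ∷_)))

module _ {n : ℕ} where

  eval-act : ∀ (σ : Fin n → Fin n) (g : BF n) u → eval (act σ g) u ≡ eval g (actPt σ u)
  eval-act σ g = eval-tab (eval g ∘ actPt σ)

  act-cong : ∀ {σ τ : Fin n → Fin n} → (∀ i → σ i ≡ τ i) → ∀ (g : BF n) → act σ g ≡ act τ g
  act-cong σ≗τ g = tab-cong λ u → cong (eval g) (tabulate-cong (cong (lookup u) ∘ σ≗τ))

  act-id : ∀ (g : BF n) → act id g ≡ g
  act-id g = trans (tab-cong (cong (eval g) ∘ tabulate∘lookup)) (tab-eval g)

  act-∘ : ∀ (ρ σ : Fin n → Fin n) (g : BF n) → act ρ (act σ g) ≡ act (ρ ∘ σ) g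
  act-∘ ρ σ g = tab-cong λ u → trans (eval-act σ g (actPt ρ u))
    (cong (eval g) (tabulate-cong (lookup∘tabulate (lookup u ∘ ρ) ∘ σ)))

  act-pointwise : ∀ (_⊕_ : Bool → Bool → Bool) σ (a b : BF n) →
                  act σ (tab λ u → eval a u ⊕ eval b u) ≡ tab λ u → eval (act σ a) u ⊕ eval (act σ b) u
  act-pointwise _⊕_ σ a b = tab-cong λ u →
    trans (eval-tab _ (actPt σ u)) (sym (cong₂ _⊕_ (eval-act σ a u) (eval-act σ b u)))

∈-allPoints : ∀ {n} (u : Point n) → u ∈ allPoints n
∈-allPoints [] = here refl
∈-allPoints (false ∷ u) = ∈-++⁺ˡ (∈-map⁺ (false ∷_) (∈-allPoints u))
∈-allPoints (true ∷ u) = ∈-++⁺ʳ _ (∈-map⁺ (true ∷_) (∈-allPoints u))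

leqPt-lookup : ∀ {n} {u v : Point n} → T (leqPt u v) → ∀ i → T (lookup u i ≤ᵇ lookup v i)
leqPt-lookup {u = a ∷ _} {b ∷ _} u≤v zero = proj₁ (Equivalence.to (T-∧ {a ≤ᵇ b}) u≤v)
leqPt-lookup {u = a ∷ u} {b ∷ v} u≤v (suc i) =
  leqPt-lookup {u = u} {v} (proj₂ (Equivalence.to (T-∧ {a ≤ᵇ b}) u≤v)) i

leqPt-tabulate : ∀ {n} {f g : Fin n → Bool} → (∀ i → T (f i ≤ᵇ g i)) → T (leqPt (tabulate f) (tabulate g))
leqPt-tabulate {zero} _ = _
leqPt-tabulate {suc n} {f} {g} f≤g =
  Equivalence.from (T-∧ {f zero ≤ᵇ g zero}) (f≤g zero , leqPt-tabulate (f≤g ∘ suc))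

module _ {n : ℕ} where

  leqBF⇒ : ∀ {f g : BF n} → T (leqBF f g) → ∀ u → T (eval f u ≤ᵇ eval g u)
  leqBF⇒ f≤g u = T-all⁻ _ (allPoints n) f≤g (∈-allPoints u)

  leqBF⇐ : ∀ {f g : BF n} → (∀ u → T (eval f u ≤ᵇ eval g u)) → T (leqBF f g)
  leqBF⇐ f≤g = T-all⁺ _ (allPoints n) λ {u} _ → f≤g u

  monotoneᵇ⇒ : ∀ {f : BF n} → T (monotoneᵇ f) → ∀ {u v} → T (leqPt u v) → T (eval f u ≤ᵇ eval f v)
  monotoneᵇ⇒ f-mono {u} {v} =
    ≤ᵇ-elim (T-all⁻ _ (allPoints n) (T-all⁻ _ (allPoints n) f-mono (∈-allPoints u)) (∈-allPoints v))

  monotoneᵇ⇐ : ∀ {f : BF n} → (∀ {u v} → T (leqPt u v) → T (eval f u ≤ᵇ eval f v)) → T (monotoneᵇ f)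
  monotoneᵇ⇐ {f} f-mono = T-all⁺ _ (allPoints n) λ {u} _ → T-all⁺ _ (allPoints n) λ {v} _ →
    ≤ᵇ-intro {leqPt u v} (f-mono {u} {v})

module _ {n : ℕ} (σ : Fin n → Fin n) where

  ≤ᵇ-act : ∀ {f g : BF n} {u v} → T (eval f (actPt σ u) ≤ᵇ eval g (actPt σ v)) →
           T (eval (act σ f) u ≤ᵇ eval (act σ g) v)
  ≤ᵇ-act {f} {g} {u} {v} = subst₂ (λ a b → T (a ≤ᵇ b)) (sym (eval-act σ f u)) (sym (eval-act σ g v))

  leqPt-act : ∀ {u v} → T (leqPt u v) → T (leqPt (actPt σ u) (actPt σ v))
  leqPt-act {u} {v} u≤v = leqPt-tabulate (leqPt-lookup {u = u} {v} u≤v ∘ σ)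

  leqBF-act : ∀ (f g : BF n) → T (leqBF f g) → T (leqBF (act σ f) (act σ g))
  leqBF-act f g f≤g = leqBF⇐ λ u → ≤ᵇ-act {f} {g} (leqBF⇒ {f = f} {g} f≤g (actPt σ u))

  monotone-act : ∀ (f : BF n) → T (monotoneᵇ f) → T (monotoneᵇ (act σ f))
  monotone-act f f-mono = monotoneᵇ⇐ {f = act σ f} λ {u} {v} u≤v →
    ≤ᵇ-act {f} {f} {u} {v} (monotoneᵇ⇒ {f = f} f-mono (leqPt-act {u} {v} u≤v))

module _ {n : ℕ} where

  infixr 8 _·_
  _·_ : Permutation n n → BF n → BF n
  π · g = act (π ⟨$⟩ʳ_) g

  flip-· : ∀ π g → flip π · π · g ≡ g
  flip-· π g = trans (act-∘ _ _ g) (trans (act-cong (λ _ → inverseˡ π) g) (act-id g))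

  ·-flip : ∀ π g → π · flip π · g ≡ g
  ·-flip π g = trans (act-∘ _ _ g) (trans (act-cong (λ _ → inverseʳ π) g) (act-id g))

  ·-∘ : ∀ π ρ g → π · ρ · g ≡ (ρ ∘ₚ π) · g
  ·-∘ π ρ = act-∘ _ _

  ·-injective : ∀ π {f g} → π · f ≡ π · g → f ≡ g
  ·-injective π {f} {g} πf≡πg = trans (sym (flip-· π f)) (trans (cong (flip π ·_) πf≡πg) (flip-· π g))

  leqBF-· : ∀ π f g → leqBF (π · f) (π · g) ≡ leqBF f g
  leqBF-· π f g = T-ext
    (λ πf≤πg → subst₂ (λ a b → T (leqBF a b)) (flip-· π f) (flip-· π g)
                 (leqBF-act _ (π · f) (π · g) πf≤πg))
    (leqBF-act _ f g)

  module _ (π : Permutation n n) where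

    ·-∣ : ∀ a b → π · (a ∣ᶠ b) ≡ π · a ∣ᶠ π · b
    ·-∣ = act-pointwise _∨_ _

    ·-& : ∀ a b → π · (a &ᶠ b) ≡ π · a &ᶠ π · b
    ·-& = act-pointwise _∧_ _

    ·-∣₃ : ∀ a b c → π · (a ∣ᶠ b ∣ᶠ c) ≡ π · a ∣ᶠ π · b ∣ᶠ π · c
    ·-∣₃ a b c = trans (·-∣ (a ∣ᶠ b) c) (cong (_∣ᶠ π · c) (·-∣ a b))

    ·-&₃ : ∀ a b c → π · (a &ᶠ b &ᶠ c) ≡ π · a &ᶠ π · b &ᶠ π · c
    ·-&₃ a b c = trans (·-& (a &ᶠ b) c) (cong (_&ᶠ π · c) (·-& a b))

    ·-∣₆ : ∀ a b c d e f →
           π · (a ∣ᶠ b ∣ᶠ c ∣ᶠ d ∣ᶠ e ∣ᶠ f) ≡ π · a ∣ᶠ π · b ∣ᶠ π · c ∣ᶠ π · d ∣ᶠ π · e ∣ᶠ π · f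
    ·-∣₆ a b c d e f = trans (·-∣ _ f) (cong (_∣ᶠ π · f) (trans (·-∣ _ e) (cong (_∣ᶠ π · e)
      (trans (·-∣ _ d) (cong (_∣ᶠ π · d) (·-∣₃ a b c))))))

    ·-&₆ : ∀ a b c d e f →
           π · (a &ᶠ b &ᶠ c &ᶠ d &ᶠ e &ᶠ f) ≡ π · a &ᶠ π · b &ᶠ π · c &ᶠ π · d &ᶠ π · e &ᶠ π · f
    ·-&₆ a b c d e f = trans (·-& _ f) (cong (_&ᶠ π · f) (trans (·-& _ e) (cong (_&ᶠ π · e)
      (trans (·-& _ d) (cong (_&ᶠ π · d) (·-&₃ a b c))))))

∈-allBF : ∀ {n} (f : BF n) → f ∈ allBF n
∈-allBF {zero} false = here refl
∈-allBF {zero} true = there (here refl)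
∈-allBF {suc n} (f₀ , f₁) = ∈-cartesianProduct⁺ (∈-allBF f₀) (∈-allBF f₁)

allBF-unique : ∀ {n} → Unique (allBF n)
allBF-unique {zero} = ((λ ()) ∷ []) ∷ [] ∷ []
allBF-unique {suc n} = Unique.cartesianProduct⁺ allBF-unique allBF-unique

module _ {n : ℕ} where

  D-unique : Unique (D n)
  D-unique = Unique.filter⁺ (T? ∘ monotoneᵇ) allBF-unique

  ∈-D : ∀ (f : BF n) → T (monotoneᵇ f) → f ∈ D n
  ∈-D f = ∈-filter⁺ (T? ∘ monotoneᵇ) (∈-allBF f)

  All-monotone-D : All (T ∘ monotoneᵇ) (D n)
  All-monotone-D = all-filter (T? ∘ monotoneᵇ) (allBF n)

  ·-permutes-D : ∀ (π : Permutation n n) → map (π ·_) (D n) ↭ D n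
  ·-permutes-D π = ∼bag⇒↭ (unique∧set⇒bag (Unique.map⁺ (·-injective π) D-unique) D-unique (mk⇔ to from))
    where
    ∈-D-· : ∀ ρ {g} → g ∈ D n → ρ · g ∈ D n
    ∈-D-· ρ {g} g∈D = ∈-D (ρ · g) (monotone-act _ g (All.lookup All-monotone-D g∈D))
    to : ∀ {g} → g ∈ map (π ·_) (D n) → g ∈ D n
    to g∈πD with ∈-map⁻ (π ·_) g∈πD
    ... | f , f∈D , refl = ∈-D-· π f∈D
    from : ∀ {g} → g ∈ D n → g ∈ map (π ·_) (D n)
    from {g} g∈D = subst (_∈ map (π ·_) (D n)) (·-flip π g) (∈-map⁺ (π ·_) (∈-D-· (flip π) g∈D))

-- Invariance of F under a simultaneous permutation of the variables

module _ {n : ℕ} where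

  sumD : (BF n → ℕ) → ℕ
  sumD k = sum (map k (D n))

  -- Fval a (b , c , d , e , f) unfolds to the paper's U · L, namely
  --   upper (a ∣ᶠ ⋯ ∣ᶠ f) (a ∣ᶠ b ∣ᶠ d) (a ∣ᶠ c ∣ᶠ e) (b ∣ᶠ c ∣ᶠ f) (d ∣ᶠ e ∣ᶠ f)
  --   * lower (a &ᶠ ⋯ &ᶠ f) (a &ᶠ b &ᶠ c) (a &ᶠ d &ᶠ e) (b &ᶠ d &ᶠ f) (c &ᶠ e &ᶠ f).
  upper lower : (J A B C E : BF n) → ℕ
  upper J A B C E = sum (map (λ u → re A u * re B u * re C u * re E u) (filterᵇ (leqBF J) (D n)))
  lower J A B C E = sum (map (λ u → re u A * re u B * re u C * re u E) (filterᵇ (λ u → leqBF u J) (D n)))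

  module _ (π : Permutation n n) where

    sumD-· : ∀ k → sumD (k ∘ (π ·_)) ≡ sumD k
    sumD-· = sum-map-reindex (·-permutes-D π)

    re-· : ∀ x y → re (π · x) (π · y) ≡ re x y
    re-· x y = length-filterᵇ-reindex (·-permutes-D π) λ z → cong₂ _∧_ (leqBF-· π x z) (leqBF-· π z y)

    upper-· : ∀ J A B C E → upper (π · J) (π · A) (π · B) (π · C) (π · E) ≡ upper J A B C E
    upper-· J A B C E = sum-filterᵇ-reindex (·-permutes-D π) (leqBF-· π J) λ u →
      cong₂ _*_ (cong₂ _*_ (cong₂ _*_ (re-· A u) (re-· B u)) (re-· C u)) (re-· E u)

    lower-· : ∀ J A B C E → lower (π · J) (π · A) (π · B) (π · C) (π · E) ≡ lower J A B C E
    lower-· J A B C E = sum-filterᵇ-reindex (·-permutes-D π) (λ u → leqBF-· π u J) λ u →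
      cong₂ _*_ (cong₂ _*_ (cong₂ _*_ (re-· u A) (re-· u B)) (re-· u C)) (re-· u E)

    Fval-· : ∀ a t → Fval (π · a) (act5 (π ⟨$⟩ʳ_) t) ≡ Fval a t
    Fval-· a (b , c , d , e , f)
      rewrite sym (·-∣₆ π a b c d e f)
            | sym (·-∣₃ π a b d) | sym (·-∣₃ π a c e) | sym (·-∣₃ π b c f) | sym (·-∣₃ π d e f)
            | sym (·-&₆ π a b c d e f)
            | sym (·-&₃ π a b c) | sym (·-&₃ π a d e) | sym (·-&₃ π b d f) | sym (·-&₃ π c e f)
      = cong₂ _*_ (upper-· _ _ _ _ _) (lower-· _ _ _ _ _)

  sum-D5 : ∀ (H : Tup5 n → ℕ) →
           sum (map H (D5 n)) ≡ sumD λ b → sumD λ c → sumD λ d → sumD λ e → sumD λ f → H (b , c , d , e , f)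
  sum-D5 H = trans (sum-concatMap H _ (D n)) (cong sum (map-cong (λ b →
    trans (sum-concatMap H _ (D n)) (cong sum (map-cong (λ c →
    trans (sum-concatMap H _ (D n)) (cong sum (map-cong (λ d →
    trans (sum-concatMap H _ (D n)) (cong sum (map-cong (λ e →
    cong sum (sym (map-∘ (D n)))) (D n)))) (D n)))) (D n)))) (D n)))

  sum-D5-· : ∀ π (H : Tup5 n → ℕ) → sum (map (H ∘ act5 (π ⟨$⟩ʳ_)) (D5 n)) ≡ sum (map H (D5 n))
  sum-D5-· π H = trans (sum-D5 _) (trans
    (trans (sumD-· π _) (sumD-cong λ b → trans (sumD-· π _) (sumD-cong λ c →
     trans (sumD-· π _) (sumD-cong λ d → trans (sumD-· π _) (sumD-cong λ e → sumD-· π _)))))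
    (sym (sum-D5 H)))
    where
    sumD-cong : ∀ {k k′ : BF n → ℕ} → (∀ x → k x ≡ k′ x) → sumD k ≡ sumD k′
    sumD-cong k≗k′ = cong sum (map-cong k≗k′ (D n))

  All-InD5 : All InD5 (D5 n)
  All-InD5 =
    concat⁺ (All.map⁺ (All-D λ b-mono →
    concat⁺ (All.map⁺ (All-D λ c-mono →
    concat⁺ (All.map⁺ (All-D λ d-mono →
    concat⁺ (All.map⁺ (All-D λ e-mono →
    All.map⁺ (All-D λ f-mono →
    Equivalence.to T-≡ (∧-intro b-mono (∧-intro c-mono (∧-intro d-mono (∧-intro e-mono f-mono)))))))))))))
    where
    All-D : ∀ {P : BF n → Set} → (∀ {f} → T (monotoneᵇ f) → P f) → All P (D n)
    All-D mono⇒P = All.map mono⇒P All-monotone-D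
    ∧-intro : ∀ {a b} → T a → T b → T (a ∧ b)
    ∧-intro {a} ta tb = Equivalence.from (T-∧ {a}) (ta , tb)

  sumF : (Tup5 n → Bool) → BF n → ℕ
  sumF Y g = sum (map (Fval g) (filterᵇ Y (D5 n)))

  sumF-· : ∀ {Y} π → (∀ t → InD5 t → Y (act5 (π ⟨$⟩ʳ_) t) ≡ Y t) → ∀ g → sumF Y (π · g) ≡ sumF Y g
  sumF-· {Y} π Y-inv g = begin
    sum (map (Fval (π · g)) (filterᵇ Y (D5 n)))                  ≡⟨ sum-filterᵇ Y _ (D5 n) ⟩
    sum (map (λ t → if Y t then Fval (π · g) t else 0) (D5 n))   ≡⟨ sum-D5-· π _ ⟨
    sum (map (λ t → if Y (σ t) then Fval (π · g) (σ t) else 0) (D5 n))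
      ≡⟨ cong sum (map-cong-local (All.map (λ {t} t∈D5 →
           cong₂ (if_then_else 0) (Y-inv t t∈D5) (Fval-· π g t)) All-InD5)) ⟩
    sum (map (λ t → if Y t then Fval g t else 0) (D5 n))         ≡⟨ sum-filterᵇ Y _ (D5 n) ⟨
    sum (map (Fval g) (filterᵇ Y (D5 n)))                        ∎
    where
    open ≡-Reasoning
    σ = act5 (π ⟨$⟩ʳ_)

eqBF-sound : ∀ {n} {f g : BF n} → T (eqBF f g) → f ≡ g
eqBF-sound {zero} {false} {false} _ = refl
eqBF-sound {zero} {true} {true} _ = refl
eqBF-sound {suc n} {f₀ , f₁} {g₀ , g₁} f≡g =
  let f₀≡g₀ , f₁≡g₁ = Equivalence.to (T-∧ {eqBF f₀ g₀}) f≡g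
  in cong₂ _,_ (eqBF-sound f₀≡g₀) (eqBF-sound f₁≡g₁)

eqBF-refl : ∀ {n} (f : BF n) → T (eqBF f f)
eqBF-refl {zero} false = _
eqBF-refl {zero} true = _
eqBF-refl {suc n} (f₀ , f₁) = Equivalence.from (T-∧ {eqBF f₀ f₀}) (eqBF-refl f₀ , eqBF-refl f₁)

∈-allVecs : ∀ n k (v : Vec (Fin n) k) → v ∈ allVecs n k
∈-allVecs n zero [] = here refl
∈-allVecs n (suc k) (i ∷ v) = ∈-concatMap⁺ (λ j → map (j ∷_) (allVecs n k))
  (Any.map (λ { refl → ∈-map⁺ (i ∷_) (∈-allVecs n k v) }) (∈-allFin i))

injective⇒surjective : ∀ {n} {σ : Fin n → Fin n} → Injective _≡_ _≡_ σ → ∀ j → ∃ λ i → σ i ≡ j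
injective⇒surjective {suc n} {σ} σ-inj j with any? (λ i → σ i ≟ j)
... | yes found = found
... | no ¬found = ⊥-elim (1+n≰n (injective⇒≤ punchOut-σ-injective))
  where
  j≢σ : ∀ i → j ≢ σ i
  j≢σ i j≡σi = ¬found (i , sym j≡σi)
  punchOut-σ-injective : Injective _≡_ _≡_ (λ i → punchOut (j≢σ i))
  punchOut-σ-injective eq = σ-inj (punchOut-injective (j≢σ _) (j≢σ _) eq)

module _ {n : ℕ} {σ : Fin n → Fin n} where

  injectiveᵇ-sound : T (injectiveᵇ σ) → Injective _≡_ _≡_ σ
  injectiveᵇ-sound σ-inj {i} {j} σi≡σj
    with T-all⁻ _ (allFin n) (T-all⁻ _ (allFin n) σ-inj (∈-allFin i)) (∈-allFin j)
  ... | check with i ≟ j | σ i ≟ σ j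
  ...   | yes i≡j | _ = i≡j
  ...   | no _ | yes _ = ⊥-elim check
  ...   | no _ | no σi≢σj = ⊥-elim (σi≢σj σi≡σj)

  injectiveᵇ-complete : Injective _≡_ _≡_ σ → T (injectiveᵇ σ)
  injectiveᵇ-complete σ-inj = T-all⁺ _ (allFin n) λ {i} _ → T-all⁺ _ (allFin n) λ {j} _ → check i j
    where
    check : ∀ i j → T (⌊ i ≟ j ⌋ ∨ not ⌊ σ i ≟ σ j ⌋)
    check i j with i ≟ j | σ i ≟ σ j
    ... | yes _ | _ = _
    ... | no _ | no _ = _
    ... | no i≢j | yes σi≡σj = ⊥-elim (i≢j (σ-inj σi≡σj))

  injective⇒permutation : Injective _≡_ _≡_ σ → Permutation n n
  injective⇒permutation σ-inj =
    permutation σ (proj₁ ∘ surj) (proj₂ ∘ surj) (λ i → σ-inj (proj₂ (surj (σ i))))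
    where surj = injective⇒surjective σ-inj

module _ {n : ℕ} where

  inClass⇒ : ∀ {f g : BF n} → T (inClassᵇ f g) → ∃ λ (π : Permutation n n) → g ≡ π · f
  inClass⇒ {f} {g} g∈[f] with find (any⁻ _ (Sym n) g∈[f])
  ... | σ , σ∈Sym , g≡σf = injective⇒permutation (injectiveᵇ-sound σ-inj) , eqBF-sound g≡σf
    where σ-inj = proj₂ (∈-filter⁻ (T? ∘ injectiveᵇ) {xs = map lookup (allVecs n n)} σ∈Sym)

  inClass⇐ : ∀ (π : Permutation n n) {f g} → g ≡ π · f → T (inClassᵇ f g)
  inClass⇐ π {f} g≡πf = subst (T ∘ inClassᵇ f) (sym g≡πf)
    (any⁺ _ (lose σ∈Sym (subst (T ∘ eqBF (π · f)) (act-cong π≗σ f) (eqBF-refl (π · f)))))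
    where
    σ : Fin n → Fin n
    σ = lookup (tabulate (π ⟨$⟩ʳ_))
    π≗σ : ∀ i → π ⟨$⟩ʳ i ≡ σ i
    π≗σ i = sym (lookup∘tabulate _ i)
    σ-inj : Injective _≡_ _≡_ σ
    σ-inj {i} {j} σi≡σj = begin
      i                      ≡⟨ inverseˡ π ⟨
      π ⟨$⟩ˡ (π ⟨$⟩ʳ i)      ≡⟨ cong (π ⟨$⟩ˡ_) (trans (π≗σ i) (trans σi≡σj (sym (π≗σ j)))) ⟩
      π ⟨$⟩ˡ (π ⟨$⟩ʳ j)      ≡⟨ inverseˡ π ⟩
      j                      ∎
      where open ≡-Reasoning
    σ∈Sym : σ ∈ Sym n
    σ∈Sym = ∈-filter⁺ (T? ∘ injectiveᵇ) (∈-map⁺ lookup (∈-allVecs n n (tabulate (π ⟨$⟩ʳ_))))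
      (injectiveᵇ-complete σ-inj)

  inClass-isEquivalence : IsEquivalence (λ (f g : BF n) → T (inClassᵇ f g))
  inClass-isEquivalence = record { refl = inClass-refl ; sym = inClass-sym ; trans = inClass-trans }
    where
    inClass-refl : ∀ {f} → T (inClassᵇ f f)
    inClass-refl {f} = inClass⇐ Permutation.id {f} {f} (sym (act-id f))
    inClass-sym : ∀ {f g} → T (inClassᵇ f g) → T (inClassᵇ g f)
    inClass-sym {f} {g} g∈[f] =
      let π , g≡πf = inClass⇒ {f} {g} g∈[f]
      in inClass⇐ (flip π) {g} {f} (trans (sym (flip-· π f)) (cong (flip π ·_) (sym g≡πf)))
    inClass-trans : ∀ {f g h} → T (inClassᵇ f g) → T (inClassᵇ g h) → T (inClassᵇ f h)
    inClass-trans {f} {g} {h} g∈[f] h∈[g] =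
      let π , g≡πf = inClass⇒ {f} {g} g∈[f]
          ρ , h≡ρg = inClass⇒ {g} {h} h∈[g]
      in inClass⇐ (π ∘ₚ ρ) {f} {h} (trans h≡ρg (trans (cong (ρ ·_) g≡πf) (·-∘ ρ π f)))

  sumF-inClass : ∀ {Y} → (∀ π t → InD5 t → Y (act5 (π ⟨$⟩ʳ_) t) ≡ Y t) →
                 ∀ {f g} → T (inClassᵇ f g) → sumF Y g ≡ sumF Y f
  sumF-inClass {Y} Y-inv {f} {g} g∈[f] =
    let π , g≡πf = inClass⇒ {f} {g} g∈[f] in trans (cong (sumF Y) g≡πf) (sumF-· π (Y-inv π) f)

lemma13 : (n m : ℕ) → 1 < m → (Y : Tup5 n → Bool)
          → (∀ (π : Permutation n n) (t : Tup5 n) → InD5 t → Y (act5 (π ⟨$⟩ʳ_) t) ≡ Y t)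
          → (x y : BF n) → InD x → InD y → ∃ (λ (π : Permutation n n) → x ≡ act (π ⟨$⟩ʳ_) y)
          → (Fsingle x Y ≡ Fsingle y Y)
            × (Fclass x Y ≡ γ x * Fsingle x Y)
            × (m ∣ γ x → m ∣ Fclass x Y)
            × (m ∣ FsetY (E n m) Y)
lemma13 n m _ Y Y-inv x y _ _ (π , refl) =
    cong (_+ 0) (sumF-· π (Y-inv π) y)
  , Fclass≡γ*Fsingle x
  , (λ m∣γx → subst (m ∣_) (sym (Fclass≡γ*Fsingle x)) (∣-trans m∣γx (m∣m*n _)))
  , ∣-sum-filterᵇ (sumF Y) (sumF-inClass Y-inv)
      (λ g → ⌊ m ∣? γ g ⌋) (cong (λ k → ⌊ m ∣? k ⌋) ∘ classSize-cong) toWitness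
  where
  open EquivalenceClasses inClass-isEquivalence (D n)
  Fclass≡γ*Fsingle : ∀ g → Fclass g Y ≡ γ g * Fsingle g Y
  Fclass≡γ*Fsingle g = trans (sum-class (sumF Y) (sumF-inClass Y-inv) g) (cong (γ g *_) (sym (+-identityʳ _)))
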